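{- For any integer $\ell\ge1$ and any two graphs $G_1$ and $G_2$, $\chi_\ell(G_1\boxtimes G_2)\le \chi_\ell(G_1)\cdot\bar{\chi}_\ell(G_2)$.
   Context: A colouring $\varphi:V(G)\to\mathbb{N}$ is an $\ell$-ranking if for every non-trivial path $u_0,\ldots,u_p$ in $G$ of length $p\le \ell$, either $\varphi(u_0)\neq\varphi(u_p)$ or $\varphi(u_0)<\max\{\varphi(u_0),\ldots,\varphi(u_p)\}$; $\chi_\ell(G)$ is the minimum number of colours in an $\ell$-ranking. $\bar{\chi}_\ell(G)$, the distance-$\ell$ colouring number, is the minimum number of colours in a colouring of $G$ such that the endpoints of every non-trivial path of length at most $\ell$ get distinct colours. The strong product $G_1\boxtimes G_2$ has vertex set $V(G_1)\times V(G_2)$, with $(v_1,v_2)(w_1,w_2)$ an edge iff ($v_1=w_1$ and $v_2w_2\in E(G_2)$) or ($v_2=w_2$ and $v_1w_1\in E(G_1)$) or ($v_1w_1\in E(G_1)$ and $v_2w_2\in E(G_2)$). -}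

module Defs where

open import Data.Nat using (ℕ; zero; suc; _≤_; _<_; _⊔_)
open import Data.Fin using (Fin; zero; suc; toℕ; inject₁; fromℕ)
open import Data.Product using (_×_; _,_; Σ; proj₁; proj₂)
open import Data.Sum using (_⊎_)
open import Relation.Binary.PropositionalEquality using (_≡_; _≢_)
open import Relation.Nullary using (¬_)
open import Function.Definitions using (Injective)

record Graph : Set₁ where
  field
    V      : Set
    E      : V → V → Set
    sym    : ∀ {u v} → E u v → E v u
    irrefl : ∀ {u} → ¬ E u u
open Graph public

record Path (G : Graph) (p : ℕ) : Set where
  field
    vtx      : Fin (suc p) → V G
    distinct : Injective _≡_ _≡_ vtx
    adj      : (i : Fin p) → E G (vtx (inject₁ i)) (vtx (suc i))
open Path public

start : ∀ {G p} → Path G p → V G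
start P = vtx P zero

end : ∀ {G p} → Path G p → V G
end {p = p} P = vtx P (fromℕ p)

bigMax : ∀ {n} → (Fin n → ℕ) → ℕ
bigMax {zero}  f = 0
bigMax {suc n} f = f zero ⊔ bigMax (λ i → f (suc i))

Colouring : Graph → ℕ → Set
Colouring G k = V G → Fin k

IsRanking : (ℓ : ℕ) (G : Graph) {k : ℕ} → Colouring G k → Set
IsRanking ℓ G φ =
  ∀ p → 1 ≤ p → p ≤ ℓ → (P : Path G p) →
    (φ (start P) ≢ φ (end P)) ⊎
    (toℕ (φ (start P)) < bigMax (λ i → toℕ (φ (vtx P i))))

IsDistColouring : (ℓ : ℕ) (G : Graph) {k : ℕ} → Colouring G k → Set
IsDistColouring ℓ G φ =
  ∀ p → 1 ≤ p → p ≤ ℓ → (P : Path G p) → φ (start P) ≢ φ (end P)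

IsMinColours : (G : Graph) → (∀ {k} → Colouring G k → Set) → ℕ → Set
IsMinColours G Good c =
  Σ (Colouring G c) (λ φ → Good φ) ×
  (∀ k (φ : Colouring G k) → Good φ → c ≤ k)

ChiRank : ℕ → Graph → ℕ → Set
ChiRank ℓ G c = IsMinColours G (IsRanking ℓ G) c

ChiDist : ℕ → Graph → ℕ → Set
ChiDist ℓ G c = IsMinColours G (IsDistColouring ℓ G) c

StrongE : (G₁ G₂ : Graph) → V G₁ × V G₂ → V G₁ × V G₂ → Set
StrongE G₁ G₂ (v₁ , v₂) (w₁ , w₂) =
  (v₁ ≡ w₁ × E G₂ v₂ w₂) ⊎ (v₂ ≡ w₂ × E G₁ v₁ w₁) ⊎ (E G₁ v₁ w₁ × E G₂ v₂ w₂)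

open import Data.Sum using (inj₁; inj₂)
open import Relation.Binary.PropositionalEquality using (refl; sym)

private
  strongSym : ∀ G₁ G₂ {x y} → StrongE G₁ G₂ x y → StrongE G₁ G₂ y x
  strongSym G₁ G₂ (inj₁ (refl , e)) = inj₁ (refl , Graph.sym G₂ e)
  strongSym G₁ G₂ (inj₂ (inj₁ (refl , e))) = inj₂ (inj₁ (refl , Graph.sym G₁ e))
  strongSym G₁ G₂ (inj₂ (inj₂ (e , f))) = inj₂ (inj₂ (Graph.sym G₁ e , Graph.sym G₂ f))

  strongIrr : ∀ G₁ G₂ {x} → ¬ StrongE G₁ G₂ x x
  strongIrr G₁ G₂ (inj₁ (_ , e)) = irrefl G₂ e
  strongIrr G₁ G₂ (inj₂ (inj₁ (_ , e))) = irrefl G₁ e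
  strongIrr G₁ G₂ (inj₂ (inj₂ (e , _))) = irrefl G₁ e

_⊠_ : Graph → Graph → Graph
G₁ ⊠ G₂ = record
  { V = V G₁ × V G₂
  ; E = StrongE G₁ G₂
  ; sym = strongSym G₁ G₂
  ; irrefl = strongIrr G₁ G₂
  }

-- Given an ℓ-ranking φ₁ of G₁ with a colours and a distance-ℓ colouring φ₂
-- of G₂ with b colours, colour (x , y) by the lexicographic pair
-- ψ(x , y) = b·φ₁(x) + φ₂(y), a colouring with a·b colours; it is an
-- ℓ-ranking of G₁ ⊠ G₂, which bounds χ_ℓ(G₁ ⊠ G₂) by minimality.
--
-- Suppose a path P of length p ≤ ℓ in the product had ψ-equal ends and no
-- interior colour above them. Then the ends agree in both coordinates of
-- the colour, and φ₁ never exceeds its start value along P. Each projection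
-- of P is a lazy walk (consecutive vertices equal or adjacent). If the
-- G₂-ends differ, the G₂-walk contains a path of length ≤ ℓ whose ends share
-- a φ₂-colour, impossible; otherwise the G₁-ends differ and the G₁-walk
-- contains a path violating the ranking property of φ₁.

module Submission where

open import Defs hiding (sym)
open import Data.Nat using (ℕ; zero; suc; _+_; _∸_; _*_; _≤_; _<_; z≤n; s≤s; s≤s⁻¹; _<?_)
open import Data.Nat.Properties
open import Data.Fin as Fin using (Fin; toℕ; inject₁; fromℕ; combine)
open import Data.Fin.Properties
  using (toℕ-injective; toℕ<n; toℕ-fromℕ; toℕ-inject₁; combine-injectiveˡ; combine-injectiveʳ; combine-monoˡ-<)
  renaming (_≟_ to _≟ᶠ_)
open import Data.Product using (_×_; _,_; proj₁; proj₂; ∃)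
open import Data.Sum using (_⊎_; inj₁; inj₂)
open import Data.Empty using (⊥; ⊥-elim)
open import Function using (_∘_)
open import Relation.Nullary using (¬_; yes; no; ¬¬-excluded-middle)
open import Relation.Binary.PropositionalEquality

module _ {V : Set} (E : V → V → Set) where

  -- A path of length q along the relation E, presented by a ℕ-indexed
  -- sequence of which only the values at 0, …, q matter; this makes
  -- dropping and prepending vertices plain index arithmetic.
  record NPath (q : ℕ) : Set where
    field
      at          : ℕ → V
      at-distinct : ∀ {i j} → i ≤ q → j ≤ q → at i ≡ at j → i ≡ j
      at-adj      : ∀ {i} → i < q → E (at i) (at (suc i))
  open NPath

  edge-path : ∀ {x y} → x ≢ y → E x y → NPath 1
  edge-path {x} {y} x≢y e = record { at = at₁ ; at-distinct = distinct₁ ; at-adj = adj₁ }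
    where
    at₁ : ℕ → V
    at₁ zero    = x
    at₁ (suc _) = y
    distinct₁ : ∀ {i j} → i ≤ 1 → j ≤ 1 → at₁ i ≡ at₁ j → i ≡ j
    distinct₁ {zero}        {zero}        _         _         _  = refl
    distinct₁ {zero}        {suc zero}    _         _         eq = ⊥-elim (x≢y eq)
    distinct₁ {suc zero}    {zero}        _         _         eq = ⊥-elim (x≢y (sym eq))
    distinct₁ {suc zero}    {suc zero}    _         _         _  = refl
    distinct₁ {suc (suc _)} {_}           (s≤s ()) _         _
    distinct₁ {_}           {suc (suc _)} _         (s≤s ()) _
    adj₁ : ∀ {i} → i < 1 → E (at₁ i) (at₁ (suc i))
    adj₁ {zero}  _        = e
    adj₁ {suc _} (s≤s ())

  drop-path : ∀ {q} (Q : NPath q) j → j ≤ q → NPath (q ∸ j)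
  drop-path {q} Q j j≤q = record
    { at          = λ i → at Q (j + i)
    ; at-distinct = λ i≤ k≤ eq → +-cancelˡ-≡ j _ _ (at-distinct Q (shift i≤) (shift k≤) eq)
    ; at-adj      = λ {i} i< →
        subst (λ k → E (at Q (j + i)) (at Q k)) (sym (+-suc j i))
              (at-adj Q (subst (_≤ q) (+-suc j i) (shift i<)))
    }
    where
    shift : ∀ {i} → i ≤ q ∸ j → j + i ≤ q
    shift {i} i≤ = subst (j + i ≤_) (m+[n∸m]≡n j≤q) (+-monoʳ-≤ j i≤)

  cons-path : ∀ {q} x (Q : NPath q) → E x (at Q 0) → (∀ {j} → j ≤ q → at Q j ≢ x) → NPath (suc q)
  cons-path {q} x Q e fresh = record { at = at′ ; at-distinct = distinct′ ; at-adj = adj′ }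
    where
    at′ : ℕ → V
    at′ zero    = x
    at′ (suc i) = at Q i
    distinct′ : ∀ {i j} → i ≤ suc q → j ≤ suc q → at′ i ≡ at′ j → i ≡ j
    distinct′ {zero}  {zero}  _       _       _  = refl
    distinct′ {zero}  {suc j} _       (s≤s h) eq = ⊥-elim (fresh h (sym eq))
    distinct′ {suc i} {zero}  (s≤s h) _       eq = ⊥-elim (fresh h eq)
    distinct′ {suc i} {suc j} (s≤s h) (s≤s h′) eq = cong suc (at-distinct Q h h′ eq)
    adj′ : ∀ {i} → i < suc q → E (at′ i) (at′ (suc i))
    adj′ {zero}  _       = e
    adj′ {suc i} (s≤s h) = at-adj Q h

  IsLazyWalk : ∀ {p} → (Fin (suc p) → V) → Set
  IsLazyWalk {p} w = (i : Fin p) → (w (inject₁ i) ≡ w (Fin.suc i)) ⊎ E (w (inject₁ i)) (w (Fin.suc i))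

  record PathWithin (p : ℕ) (w : Fin (suc p) → V) : Set where
    field
      len     : ℕ
      len-pos : 1 ≤ len
      len≤p   : len ≤ p
      path    : NPath len
      starts  : at path 0 ≡ w Fin.zero
      ends    : at path len ≡ w (fromℕ p)
      inside  : ∀ {i} → i ≤ len → ∃ λ j → at path i ≡ w j
  open PathWithin

  private
    tail : ∀ {p} → (Fin (suc (suc p)) → V) → Fin (suc p) → V
    tail w = w ∘ Fin.suc

    inside-tail : ∀ {p} {w : Fin (suc (suc p)) → V} {v} → ∃ (λ j → v ≡ tail w j) → ∃ (λ j → v ≡ w j)
    inside-tail (j , eq) = Fin.suc j , eq

  within-after-stay : ∀ {p} {w : Fin (suc (suc p)) → V} →
    w Fin.zero ≡ w (Fin.suc Fin.zero) → PathWithin p (tail w) → PathWithin (suc p) w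
  within-after-stay stay Q = record
    { len = len Q ; len-pos = len-pos Q ; len≤p = m≤n⇒m≤1+n (len≤p Q) ; path = path Q
    ; starts = trans (starts Q) (sym stay) ; ends = ends Q ; inside = inside-tail ∘ inside Q }

  within-by-edge : ∀ {p} {w : Fin (suc (suc p)) → V} → w Fin.zero ≢ w (fromℕ (suc p)) →
    E (w Fin.zero) (w (Fin.suc Fin.zero)) → w (Fin.suc Fin.zero) ≡ w (fromℕ (suc p)) →
    PathWithin (suc p) w
  within-by-edge {p} {w} ends-differ e shortcut = record
    { len = 1 ; len-pos = ≤-refl ; len≤p = s≤s z≤n
    ; path = edge-path ends-differ (subst (E (w Fin.zero)) shortcut e)
    ; starts = refl ; ends = refl ; inside = endpoint }
    where
    endpoint : ∀ {i} → i ≤ 1 → ∃ λ j → at (edge-path ends-differ (subst (E (w Fin.zero)) shortcut e)) i ≡ w j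
    endpoint {zero}  _ = Fin.zero , refl
    endpoint {suc _} _ = fromℕ (suc p) , refl

  within-by-cut : ∀ {p} {w : Fin (suc (suc p)) → V} → w Fin.zero ≢ w (fromℕ (suc p)) →
    (Q : PathWithin p (tail w)) → ∀ {j} → j ≤ len Q → at (path Q) j ≡ w Fin.zero →
    PathWithin (suc p) w
  within-by-cut {p} {w} ends-differ Q {j} j≤ at-j = record
    { len = len Q ∸ j ; len-pos = m<n⇒0<n∸m j<len
    ; len≤p = ≤-trans (m∸n≤m (len Q) j) (m≤n⇒m≤1+n (len≤p Q))
    ; path = drop-path (path Q) j j≤
    ; starts = trans (cong (at (path Q)) (+-identityʳ j)) at-j
    ; ends = trans (cong (at (path Q)) (m+[n∸m]≡n j≤)) (ends Q)
    ; inside = λ {i} i≤ → inside-tail (inside Q (subst (j + i ≤_) (m+[n∸m]≡n j≤) (+-monoʳ-≤ j i≤))) }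
    where
    j<len : j < len Q
    j<len = ≤∧≢⇒< j≤ λ j≡len → ends-differ (trans (sym at-j) (trans (cong (at (path Q)) j≡len) (ends Q)))

  within-by-cons : ∀ {p} {w : Fin (suc (suc p)) → V} → E (w Fin.zero) (w (Fin.suc Fin.zero)) →
    (Q : PathWithin p (tail w)) → (∀ {j} → j ≤ len Q → at (path Q) j ≢ w Fin.zero) →
    PathWithin (suc p) w
  within-by-cons {w = w} e Q fresh = record
    { len = suc (len Q) ; len-pos = s≤s z≤n ; len≤p = s≤s (len≤p Q)
    ; path = cons-path (w Fin.zero) (path Q) e′ fresh
    ; starts = refl ; ends = ends Q ; inside = inside′ }
    where
    e′ = subst (E (w Fin.zero)) (sym (starts Q)) e
    inside′ : ∀ {i} → i ≤ suc (len Q) → ∃ λ j → at (cons-path (w Fin.zero) (path Q) e′ fresh) i ≡ w j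
    inside′ {zero}  _       = Fin.zero , refl
    inside′ {suc i} (s≤s h) = inside-tail (inside Q h)

  -- Induction on the walk: handle its first step, and for an edge step
  -- decide (classically) where the first vertex sits relative to the rest.
  walk-contains-path : ∀ p (w : Fin (suc p) → V) → IsLazyWalk w →
    w Fin.zero ≢ w (fromℕ p) → ¬ ¬ PathWithin p w
  walk-contains-path zero    w _    ends-differ _      = ends-differ refl
  walk-contains-path (suc p) w lazy ends-differ noPath with lazy Fin.zero
  ... | inj₁ stay =
    walk-contains-path p (tail w) (lazy ∘ Fin.suc) (ends-differ ∘ trans stay) (noPath ∘ within-after-stay stay)
  ... | inj₂ e = ¬¬-excluded-middle λ where
    (yes shortcut) → noPath (within-by-edge ends-differ e shortcut)
    (no ¬shortcut) → walk-contains-path p (tail w) (lazy ∘ Fin.suc) ¬shortcut λ Q →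
      ¬¬-excluded-middle {A = ∃ λ j → j ≤ len Q × at (path Q) j ≡ w Fin.zero} λ where
        (yes (j , j≤ , at-j)) → noPath (within-by-cut ends-differ Q j≤ at-j)
        (no fresh)            → noPath (within-by-cons e Q (λ j≤ at-j → fresh (_ , j≤ , at-j)))

open NPath
open PathWithin

toPath : (G : Graph) → ∀ {q} → NPath (E G) q → Path G q
toPath G {q} Q = record
  { vtx      = λ i → at Q (toℕ i)
  ; distinct = λ {i} {j} eq → toℕ-injective (at-distinct Q (bounded i) (bounded j) eq)
  ; adj      = λ i → subst (λ k → E G (at Q k) (at Q (suc (toℕ i)))) (sym (toℕ-inject₁ i)) (at-adj Q (toℕ<n i))
  }
  where
  bounded : (i : Fin (suc q)) → toℕ i ≤ q
  bounded i = s≤s⁻¹ (toℕ<n i)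

end-toPath : (G : Graph) → ∀ {q} (Q : NPath (E G) q) → end (toPath G Q) ≡ at Q q
end-toPath G {q} Q = cong (at Q) (toℕ-fromℕ q)

bigMax-≥ : ∀ {n} (g : Fin n → ℕ) i → g i ≤ bigMax g
bigMax-≥ g Fin.zero    = m≤m⊔n _ _
bigMax-≥ g (Fin.suc i) = ≤-trans (bigMax-≥ (g ∘ Fin.suc) i) (m≤n⊔m _ _)

bigMax-< : ∀ {n} (g : Fin n → ℕ) {x} → x < bigMax g → ∃ λ i → x < g i
bigMax-< {zero}  g ()
bigMax-< {suc n} g {x} x< with ⊔-sel (g Fin.zero) (bigMax (g ∘ Fin.suc))
... | inj₁ eq = Fin.zero , subst (x <_) eq x<
... | inj₂ eq with bigMax-< (g ∘ Fin.suc) (subst (x <_) eq x<)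
...   | i , x<gi = Fin.suc i , x<gi

module _ (ℓ : ℕ) (G : Graph) {k : ℕ} (φ : Colouring G k)
         {p : ℕ} (p≤ℓ : p ≤ ℓ) (w : Fin (suc p) → V G) (lazy : IsLazyWalk (E G) w)
         (ends-differ : w Fin.zero ≢ w (fromℕ p)) where

  private
    same-end-colours : (Q : PathWithin (E G) p w) → φ (w Fin.zero) ≡ φ (w (fromℕ p)) →
      φ (start (toPath G (path Q))) ≡ φ (end (toPath G (path Q)))
    same-end-colours Q same =
      trans (cong φ (starts Q)) (trans same (cong φ (sym (trans (end-toPath G (path Q)) (ends Q)))))

  distColouring-walk : IsDistColouring ℓ G φ → φ (w Fin.zero) ≢ φ (w (fromℕ p))
  distColouring-walk dist same = walk-contains-path (E G) p w lazy ends-differ λ Q →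
    dist (len Q) (len-pos Q) (≤-trans (len≤p Q) p≤ℓ) (toPath G (path Q)) (same-end-colours Q same)

  ranking-walk : IsRanking ℓ G φ → φ (w Fin.zero) ≡ φ (w (fromℕ p)) →
    ¬ (∀ i → toℕ (φ (w i)) ≤ toℕ (φ (w Fin.zero)))
  ranking-walk rank same below = walk-contains-path (E G) p w lazy ends-differ λ Q →
    violates Q (rank (len Q) (len-pos Q) (≤-trans (len≤p Q) p≤ℓ) (toPath G (path Q)))
    where
    violates : (Q : PathWithin (E G) p w) → let R = toPath G (path Q) in
      (φ (start R) ≢ φ (end R)) ⊎ (toℕ (φ (start R)) < bigMax (λ i → toℕ (φ (vtx R i)))) → ⊥
    violates Q (inj₁ differ) = differ (same-end-colours Q same)
    violates Q (inj₂ below-max) with bigMax-< (λ i → toℕ (φ (at (path Q) (toℕ i)))) below-max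
    ... | i , above with inside Q (s≤s⁻¹ (toℕ<n i))
    ...   | j , at-i = <⇒≱ (subst₂ (λ u v → toℕ (φ u) < toℕ (φ v)) (starts Q) at-i above) (below j)

combine-≤⇒≤ˡ : ∀ {a b} (i k : Fin a) (j l : Fin b) →
  toℕ (combine i j) ≤ toℕ (combine k l) → toℕ i ≤ toℕ k
combine-≤⇒≤ˡ i k j l ≤c = ≮⇒≥ λ k<i → <⇒≱ (combine-monoˡ-< l j k<i) ≤c

module StrongProduct (G₁ G₂ : Graph) where

  module _ {p : ℕ} (P : Path (G₁ ⊠ G₂) p) where

    walk₁ : Fin (suc p) → V G₁
    walk₁ = proj₁ ∘ vtx P

    walk₂ : Fin (suc p) → V G₂
    walk₂ = proj₂ ∘ vtx P

    walk₁-lazy : IsLazyWalk (E G₁) walk₁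
    walk₁-lazy i with adj P i
    ... | inj₁ (stay , _)        = inj₁ stay
    ... | inj₂ (inj₁ (_ , e))    = inj₂ e
    ... | inj₂ (inj₂ (e , _))    = inj₂ e

    walk₂-lazy : IsLazyWalk (E G₂) walk₂
    walk₂-lazy i with adj P i
    ... | inj₁ (_ , e)           = inj₂ e
    ... | inj₂ (inj₁ (stay , _)) = inj₁ stay
    ... | inj₂ (inj₂ (_ , e))    = inj₂ e

  productColouring : ∀ {a b} → Colouring G₁ a → Colouring G₂ b → Colouring (G₁ ⊠ G₂) (a * b)
  productColouring φ₁ φ₂ (x , y) = combine (φ₁ x) (φ₂ y)

  module _ (ℓ : ℕ) {a b : ℕ} (φ₁ : Colouring G₁ a) (φ₂ : Colouring G₂ b)
           (rank₁ : IsRanking ℓ G₁ φ₁) (dist₂ : IsDistColouring ℓ G₂ φ₂) where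

    private
      ψ : Colouring (G₁ ⊠ G₂) (a * b)
      ψ = productColouring φ₁ φ₂

    product-no-peak : ∀ {p} → 1 ≤ p → p ≤ ℓ → (P : Path (G₁ ⊠ G₂) p) →
      ψ (start P) ≡ ψ (end P) → ¬ (∀ i → toℕ (ψ (vtx P i)) ≤ toℕ (ψ (start P)))
    product-no-peak {p} 1≤p p≤ℓ P same below = ¬¬-excluded-middle (λ where
      (no ends₂-differ) →
        distColouring-walk ℓ G₂ φ₂ p≤ℓ (walk₂ P) (walk₂-lazy P) ends₂-differ dist₂ same₂
      (yes ends₂-equal) →
        ranking-walk ℓ G₁ φ₁ p≤ℓ (walk₁ P) (walk₁-lazy P) (ends₁-differ ends₂-equal) rank₁ same₁ below₁)
      where
      same₁ : φ₁ (walk₁ P Fin.zero) ≡ φ₁ (walk₁ P (fromℕ p))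
      same₁ = combine-injectiveˡ (φ₁ (walk₁ P Fin.zero)) (φ₂ (walk₂ P Fin.zero)) _ _ same
      same₂ : φ₂ (walk₂ P Fin.zero) ≡ φ₂ (walk₂ P (fromℕ p))
      same₂ = combine-injectiveʳ (φ₁ (walk₁ P Fin.zero)) (φ₂ (walk₂ P Fin.zero)) _ _ same
      below₁ : ∀ i → toℕ (φ₁ (walk₁ P i)) ≤ toℕ (φ₁ (walk₁ P Fin.zero))
      below₁ i = combine-≤⇒≤ˡ _ _ _ _ (below i)
      -- distinct vertices of P cannot agree in both coordinates
      ends₁-differ : walk₂ P Fin.zero ≡ walk₂ P (fromℕ p) → walk₁ P Fin.zero ≢ walk₁ P (fromℕ p)
      ends₁-differ eq₂ eq₁ = <⇒≢ 1≤p (trans (cong toℕ (distinct P (cong₂ _,_ eq₁ eq₂))) (toℕ-fromℕ p))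

    product-ranking : IsRanking ℓ (G₁ ⊠ G₂) ψ
    product-ranking p 1≤p p≤ℓ P
      with ψ (start P) ≟ᶠ ψ (end P) | toℕ (ψ (start P)) <? bigMax (λ i → toℕ (ψ (vtx P i)))
    ... | no differ | _            = inj₁ differ
    ... | yes _     | yes below    = inj₂ below
    ... | yes same  | no not-below = ⊥-elim (product-no-peak 1≤p p≤ℓ P same λ i →
      ≤-trans (bigMax-≥ (λ i → toℕ (ψ (vtx P i))) i) (≮⇒≥ not-below))

open StrongProduct using (productColouring; product-ranking)

lemma16 : (ℓ : ℕ) → 1 ≤ ℓ → (G₁ G₂ : Graph) → (a b c : ℕ) →
    ChiRank ℓ G₁ a → ChiDist ℓ G₂ b → ChiRank ℓ (G₁ ⊠ G₂) c → c ≤ a * b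
lemma16 ℓ _ G₁ G₂ a b c ((φ₁ , rank₁) , _) ((φ₂ , dist₂) , _) (_ , c-minimal) =
  c-minimal (a * b) (productColouring G₁ G₂ φ₁ φ₂) (product-ranking G₁ G₂ ℓ φ₁ φ₂ rank₁ dist₂)
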